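{- Each of the following graphs is 3PM-admissible: (i) every odd wheel $W_n$ ($n$ odd, $n\ge 3$); (ii) every double wheel with an even number of vertices; (iii) the octahedron.
   Context: A matching covered graph $G$ (connected, every edge in some perfect matching) is 3PM-admissible if there exist three perfect matchings $M_1,M_2,M_3$ of $G$ with $M_1\cap M_2\cap M_3=\emptyset$. The wheel $W_n$ is the cycle $C_n$ together with one extra vertex (the hub) adjacent to every vertex of the cycle; it is an odd wheel when $n$ is odd. A double wheel is obtained from a wheel by expanding the hub into an edge: take a cycle $C$ whose vertex set is partitioned into two paths $P$ and $Q$ of $C$, each with at least two vertices, and add two adjacent new vertices $u,v$, with $u$ adjacent to every vertex of $P$ and $v$ adjacent to every vertex of $Q$. The octahedron is the 4-regular graph on 6 vertices $K_{2,2,2}$. -}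

module Defs where

open import Data.Nat using (ℕ; zero; suc; _+_; _≤_; _<_; _/_)
open import Data.Fin using (Fin; toℕ)
open import Data.Product using (Σ; ∃; _×_; _,_)
open import Data.Sum using (_⊎_)
open import Relation.Binary.PropositionalEquality using (_≡_; _≢_)
open import Relation.Nullary using (¬_)

-- Finite graphs on vertex set Fin order, given by an adjacency relation.
-- (All concrete adjacency relations below are symmetric by construction
-- and loop-free in the parameter ranges used.)

record Graph : Set₁ where
  field
    order : ℕ
    Adj   : Fin order → Fin order → Set
open Graph public

data Walk (G : Graph) : Fin (order G) → Fin (order G) → Set where
  here : ∀ {a} → Walk G a a
  step : ∀ {a b c} → Adj G a b → Walk G b c → Walk G a c

Connected : Graph → Set
Connected G = ∀ a b → Walk G a b

-- A perfect matching, represented by its partner function: a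
-- fixed-point-free involution mapping each vertex to a neighbour.
-- The edge ab (Adj a b) belongs to the matching iff partner a ≡ b.
record PerfectMatching (G : Graph) : Set where
  field
    partner   : Fin (order G) → Fin (order G)
    invol     : ∀ a → partner (partner a) ≡ a
    noFix     : ∀ a → partner a ≢ a
    adjacent  : ∀ a → Adj G a (partner a)
open PerfectMatching public

_∈PM_ : {G : Graph} → (Σ (Fin (order G)) λ a → Σ (Fin (order G)) λ b → Adj G a b)
      → PerfectMatching G → Set
(a , b , _) ∈PM M = partner M a ≡ b

MatchingCovered : Graph → Set
MatchingCovered G =
  Connected G ×
  (∀ a b → (e : Adj G a b) → Σ (PerfectMatching G) λ M → (a , b , e) ∈PM M)

ThreePMAdmissible : Graph → Set
ThreePMAdmissible G =
  MatchingCovered G ×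
  Σ (PerfectMatching G) λ M₁ → Σ (PerfectMatching G) λ M₂ → Σ (PerfectMatching G) λ M₃ →
    ∀ a b (e : Adj G a b) →
      ¬ (((a , b , e) ∈PM M₁) × ((a , b , e) ∈PM M₂) × ((a , b , e) ∈PM M₃))

CycAdj : ℕ → ℕ → ℕ → Set
CycAdj n i j = (suc i ≡ j) ⊎ (suc j ≡ i) ⊎ (i ≡ 0 × suc j ≡ n) ⊎ (j ≡ 0 × suc i ≡ n)

-- Wheel W_n : cycle vertices 0 … n-1, hub n.  Vertex set Fin (suc n).

WheelAdj : (n : ℕ) → Fin (suc n) → Fin (suc n) → Set
WheelAdj n a b =
  (toℕ a < n × toℕ b < n × CycAdj n (toℕ a) (toℕ b)) ⊎
  (toℕ a ≡ n × toℕ b < n) ⊎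
  (toℕ b ≡ n × toℕ a < n)

-- Double wheel with cycle C of length k on vertices 0 … k-1, split into
-- the paths P = 0 … p-1 and Q = p … k-1 (consecutive on C); new vertices
-- u = k (adjacent to P) and v = k+1 (adjacent to Q), with u ~ v.  Requires 2 ≤ p and p + 2 ≤ k.

DoubleWheelAdj : (k p : ℕ) → Fin (k + 2) → Fin (k + 2) → Set
DoubleWheelAdj k p a b =
  (toℕ a < k × toℕ b < k × CycAdj k (toℕ a) (toℕ b)) ⊎
  (toℕ a ≡ k × toℕ b < p) ⊎
  (toℕ b ≡ k × toℕ a < p) ⊎
  (toℕ a ≡ suc k × p ≤ toℕ b × toℕ b < k) ⊎
  (toℕ b ≡ suc k × p ≤ toℕ a × toℕ a < k) ⊎
  (toℕ a ≡ k × toℕ b ≡ suc k) ⊎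
  (toℕ b ≡ k × toℕ a ≡ suc k)

-- Octahedron K_{2,2,2}: parts {0,1}, {2,3}, {4,5}.

OctAdj : Fin 6 → Fin 6 → Set
OctAdj a b = toℕ a / 2 ≢ toℕ b / 2

wheel : ℕ → Graph
wheel n = record { order = suc n ; Adj = WheelAdj n }

doubleWheel : ℕ → ℕ → Graph
doubleWheel k p = record { order = k + 2 ; Adj = DoubleWheelAdj k p }

octahedron : Graph
octahedron = record { order = 6 ; Adj = OctAdj }

-- A perfect matching of these graphs is assembled from single edges and from
-- runs of consecutive rim vertices matched in pairs: deleting from the rim
-- cycle a set of cut vertices all of whose gaps have even length leaves paths
-- that are matched along the rim, and the cut vertices are matched to hubs.
--
-- In the odd wheel, deleting any one rim vertex j leaves a path with an even
-- number of vertices, so every spoke lies in a perfect matching, and every rim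
-- edge lies in one of these matchings for a hub partner of suitable parity.
-- The matchings that match the hub to rim vertices 0 and 1 pair up the rest of
-- the rim in opposite phase, so they are disjoint.
--
-- In the double wheel on an even cycle, the spokes ui and vj with i and j of
-- opposite parity cut the cycle into two even paths, which covers all spokes.
-- The two alternating perfect matchings of the cycle, completed by uv, cover
-- the rim and uv and meet only in uv, which the matching with spokes u0 and
-- v(k-1) avoids.
--
-- The octahedron has a 1-factorisation into four perfect matchings, and every
-- claim about it is decided by evaluation.

module Submission where

open import Defs
open import Data.Nat
  using (ℕ; zero; suc; pred; _+_; _*_; _∸_; _/_; _≤_; _<_; z≤n; s≤s; z<s; _≟_; _≤?_; _<?_)
open import Data.Nat.Properties
open import Data.Nat.Divisibility using (_∣_; divides)
open import Data.Product using (Σ; ∃; _×_; _,_; proj₁; proj₂)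
open import Data.Sum using (_⊎_; inj₁; inj₂)
open import Data.Empty using (⊥; ⊥-elim)
open import Function using (_∘_; case_of_)
open import Relation.Nullary using (¬_; ¬?; Dec; yes; no)
open import Relation.Nullary.Decidable using (_×-dec_; _⊎-dec_; _→-dec_; map′; toWitness; True)
open import Relation.Unary using (Pred; Decidable)
open import Relation.Binary.PropositionalEquality
open import Data.List using (List; []; _∷_)
open import Data.List.Relation.Unary.Any using (here; there)
open import Data.List.Membership.Propositional using (_∈_; _∉_)
open import Data.Fin using (Fin; toℕ; fromℕ<; fromℕ)
open import Data.Fin.Properties
  using (toℕ<n; toℕ-fromℕ<; toℕ-injective; toℕ-fromℕ; all?) renaming (_≟_ to _≟ᶠ_)

Consecutive : ℕ → ℕ → Set
Consecutive x y = suc x ≡ y ⊎ suc y ≡ x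

mate : ℕ → ℕ
mate zero = 1
mate (suc zero) = 0
mate (suc (suc x)) = suc (suc (mate x))

mate-involutive : ∀ x → mate (mate x) ≡ x
mate-involutive zero = refl
mate-involutive (suc zero) = refl
mate-involutive (suc (suc x)) = cong (suc ∘ suc) (mate-involutive x)

mate-≢ : ∀ x → mate x ≢ x
mate-≢ (suc (suc x)) eq = mate-≢ x (suc-injective (suc-injective eq))

mate-consecutive : ∀ x → Consecutive x (mate x)
mate-consecutive zero = inj₁ refl
mate-consecutive (suc zero) = inj₂ refl
mate-consecutive (suc (suc x)) with mate-consecutive x
... | inj₁ eq = inj₁ (cong (suc ∘ suc) eq)
... | inj₂ eq = inj₂ (cong (suc ∘ suc) eq)

mate-< : ∀ q {x} → x < q * 2 → mate x < q * 2
mate-< (suc q) {zero} _ = s≤s (s≤s z≤n)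
mate-< (suc q) {suc zero} _ = s≤s z≤n
mate-< (suc q) {suc (suc x)} (s≤s (s≤s x<)) = s≤s (s≤s (mate-< q x<))

mate-even : ∀ a → mate (a * 2) ≡ suc (a * 2)
mate-even zero = refl
mate-even (suc a) = cong (suc ∘ suc) (mate-even a)

mate-suc : ∀ x → mate (suc x) ≢ suc (mate x)
mate-suc (suc (suc x)) eq = mate-suc x (suc-injective (suc-injective eq))

data Parity : ℕ → Set where
  even : ∀ a → Parity (a * 2)
  odd  : ∀ a → Parity (suc (a * 2))

parity : ∀ n → Parity n
parity zero = even 0
parity (suc n) with parity n
... | even a = odd a
... | odd a = even (suc a)

odd≢even : ∀ a b → suc (a * 2) ≢ b * 2
odd≢even (suc a) (suc b) eq = odd≢even a b (suc-injective (suc-injective eq))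

*2-split : ∀ {a m} → a ≤ m → a * 2 + (m ∸ a) * 2 ≡ m * 2
*2-split {a} {m} a≤m = trans (sym (*-distribʳ-+ 2 a (m ∸ a))) (cong (_* 2) (m+[n∸m]≡n a≤m))

-- Perfect matchings of subsets of ℕ

record PerfectMatchingOn (R : ℕ → ℕ → Set) (S : Pred ℕ _) : Set where
  field
    domain?          : Decidable S
    match            : ℕ → ℕ
    match-closed     : ∀ {x} → S x → S (match x)
    match-involutive : ∀ {x} → S x → match (match x) ≡ x
    match-≢          : ∀ {x} → S x → match x ≢ x
    match-adjacent   : ∀ {x} → S x → R x (match x)
open PerfectMatchingOn

Ends : ℕ → ℕ → Pred ℕ _
Ends a b x = x ≡ a ⊎ x ≡ b

Run : ℕ → ℕ → Pred ℕ _
Run s q x = s ≤ x × x < s + q * 2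

otherEnd : ℕ → ℕ → ℕ → ℕ
otherEnd a b x with x ≟ a
... | yes _ = b
... | no _ = a

otherEnd-a : ∀ a b → otherEnd a b a ≡ b
otherEnd-a a b with a ≟ a
... | yes _ = refl
... | no a≢a = ⊥-elim (a≢a refl)

otherEnd-b : ∀ {a b} → a ≢ b → otherEnd a b b ≡ a
otherEnd-b {a} {b} a≢b with b ≟ a
... | yes b≡a = ⊥-elim (a≢b (sym b≡a))
... | no _ = refl

edgeMatching : ∀ {R a b} → a ≢ b → R a b → R b a → PerfectMatchingOn R (Ends a b)
edgeMatching {R} {a} {b} a≢b ab ba = record
  { domain?          = λ x → (x ≟ a) ⊎-dec (x ≟ b)
  ; match            = otherEnd a b
  ; match-closed     = λ { (inj₁ refl) → inj₂ a↦b ; (inj₂ refl) → inj₁ b↦a }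
  ; match-involutive = λ { (inj₁ refl) → trans (cong (otherEnd a b) a↦b) b↦a
                         ; (inj₂ refl) → trans (cong (otherEnd a b) b↦a) a↦b }
  ; match-≢          = λ { (inj₁ refl) eq → a≢b (sym (trans (sym a↦b) eq))
                         ; (inj₂ refl) eq → a≢b (trans (sym b↦a) eq) }
  ; match-adjacent   = λ { (inj₁ refl) → subst (R a) (sym a↦b) ab
                         ; (inj₂ refl) → subst (R b) (sym b↦a) ba }
  }
  where
  a↦b = otherEnd-a a b
  b↦a = otherEnd-b a≢b

module _ {R : ℕ → ℕ → Set} where

  reshape : ∀ {S T} → (∀ {x} → S x → T x) → (∀ {x} → T x → S x) →
            PerfectMatchingOn R S → PerfectMatchingOn R T
  reshape to from M = record
    { domain?          = λ x → map′ to from (domain? M x)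
    ; match            = match M
    ; match-closed     = to ∘ match-closed M ∘ from
    ; match-involutive = match-involutive M ∘ from
    ; match-≢          = match-≢ M ∘ from
    ; match-adjacent   = match-adjacent M ∘ from
    }

  relax : ∀ {R′ S} → (∀ {x y} → R x y → R′ x y) → PerfectMatchingOn R S → PerfectMatchingOn R′ S
  relax R⇒R′ M = record
    { domain?          = domain? M
    ; match            = match M
    ; match-closed     = match-closed M
    ; match-involutive = match-involutive M
    ; match-≢          = match-≢ M
    ; match-adjacent   = R⇒R′ ∘ match-adjacent M
    }

  runMatching : ∀ s q → (∀ {x y} → x < s + q * 2 → y < s + q * 2 → Consecutive x y → R x y) →
                PerfectMatchingOn R (Run s q)
  runMatching s q path = record
    { domain?          = λ x → (s ≤? x) ×-dec (x <? s + q * 2)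
    ; match            = shifted
    ; match-closed     = closed
    ; match-involutive = involutive
    ; match-≢          = irreflexive
    ; match-adjacent   = along-path
    }
    where
    shifted : ℕ → ℕ
    shifted x = s + mate (x ∸ s)
    shifted-+ : ∀ d → shifted (s + d) ≡ s + mate d
    shifted-+ d = cong (λ z → s + mate z) (m+n∸m≡n s d)
    offset : ∀ {x} → s ≤ x → ∃ λ d → s + d ≡ x
    offset {x} s≤x = x ∸ s , m+[n∸m]≡n s≤x
    mate-in-run : ∀ {d} → s + d < s + q * 2 → s + mate d < s + q * 2
    mate-in-run {d} lt = +-monoʳ-< s (mate-< q (+-cancelˡ-< s d _ lt))
    closed : ∀ {x} → Run s q x → Run s q (shifted x)
    closed (s≤x , x<) with offset s≤x
    ... | d , refl rewrite shifted-+ d = m≤m+n s _ , mate-in-run x<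
    involutive : ∀ {x} → Run s q x → shifted (shifted x) ≡ x
    involutive (s≤x , _) with offset s≤x
    ... | d , refl rewrite shifted-+ d | shifted-+ (mate d) = cong (s +_) (mate-involutive d)
    irreflexive : ∀ {x} → Run s q x → shifted x ≢ x
    irreflexive (s≤x , _) with offset s≤x
    ... | d , refl rewrite shifted-+ d = mate-≢ d ∘ +-cancelˡ-≡ s _ _
    along-path : ∀ {x} → Run s q x → R x (shifted x)
    along-path (s≤x , x<) with offset s≤x
    ... | d , refl rewrite shifted-+ d = path x< (mate-in-run x<) consecutive
      where
      consecutive : Consecutive (s + d) (s + mate d)
      consecutive with mate-consecutive d
      ... | inj₁ eq = inj₁ (trans (sym (+-suc s d)) (cong (s +_) eq))
      ... | inj₂ eq = inj₂ (trans (sym (+-suc s (mate d))) (cong (s +_) eq))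

  module _ {S T} (M : PerfectMatchingOn R S) (N : PerfectMatchingOn R T)
           (disjoint : ∀ {x} → S x → ¬ T x) where

    private
      joint : ℕ → ℕ
      joint x with domain? M x
      ... | yes _ = match M x
      ... | no _ = match N x

      joint-S : ∀ {x} → S x → joint x ≡ match M x
      joint-S {x} s with domain? M x
      ... | yes _ = refl
      ... | no ¬s = ⊥-elim (¬s s)

      joint-T : ∀ {x} → T x → joint x ≡ match N x
      joint-T {x} t with domain? M x
      ... | yes s = ⊥-elim (disjoint s t)
      ... | no _ = refl

    union : PerfectMatchingOn R (λ x → S x ⊎ T x)
    union = record
      { domain?          = λ x → domain? M x ⊎-dec domain? N x
      ; match            = joint
      ; match-closed     = closed
      ; match-involutive = involutive
      ; match-≢          = irreflexive
      ; match-adjacent   = adjacent′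
      }
      where
      closed : ∀ {x} → S x ⊎ T x → S (joint x) ⊎ T (joint x)
      closed (inj₁ s) rewrite joint-S s = inj₁ (match-closed M s)
      closed (inj₂ t) rewrite joint-T t = inj₂ (match-closed N t)
      involutive : ∀ {x} → S x ⊎ T x → joint (joint x) ≡ x
      involutive (inj₁ s) rewrite joint-S s | joint-S (match-closed M s) = match-involutive M s
      involutive (inj₂ t) rewrite joint-T t | joint-T (match-closed N t) = match-involutive N t
      irreflexive : ∀ {x} → S x ⊎ T x → joint x ≢ x
      irreflexive (inj₁ s) rewrite joint-S s = match-≢ M s
      irreflexive (inj₂ t) rewrite joint-T t = match-≢ N t
      adjacent′ : ∀ {x} → S x ⊎ T x → R x (joint x)
      adjacent′ (inj₁ s) rewrite joint-S s = match-adjacent M s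
      adjacent′ (inj₂ t) rewrite joint-T t = match-adjacent N t

    union-matchˡ : ∀ {x} → S x → match union x ≡ match M x
    union-matchˡ = joint-S

    union-matchʳ : ∀ {x} → T x → match union x ≡ match N x
    union-matchʳ = joint-T

finGraph : ℕ → (ℕ → ℕ → Set) → Graph
finGraph N R = record { order = N ; Adj = λ a b → R (toℕ a) (toℕ b) }

module _ {N} {R : ℕ → ℕ → Set} (M : PerfectMatchingOn R (_< N)) where

  private
    partner′ : Fin N → Fin N
    partner′ a = fromℕ< (match-closed M (toℕ<n a))

  toℕ-partner : ∀ a → toℕ (partner′ a) ≡ match M (toℕ a)
  toℕ-partner a = toℕ-fromℕ< _

  toPerfectMatching : PerfectMatching (finGraph N R)
  toPerfectMatching = record
    { partner  = partner′
    ; invol    = λ a → toℕ-injective (begin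
        toℕ (partner′ (partner′ a))  ≡⟨ toℕ-partner (partner′ a) ⟩
        match M (toℕ (partner′ a))  ≡⟨ cong (match M) (toℕ-partner a) ⟩
        match M (match M (toℕ a))   ≡⟨ match-involutive M (toℕ<n a) ⟩
        toℕ a                       ∎)
    ; noFix    = λ a eq → match-≢ M (toℕ<n a) (trans (sym (toℕ-partner a)) (cong toℕ eq))
    ; adjacent = λ a → subst (R (toℕ a)) (sym (toℕ-partner a)) (match-adjacent M (toℕ<n a))
    }
    where open ≡-Reasoning

  match-sym : ∀ {x y} → x < N → match M x ≡ y → match M y ≡ x
  match-sym x<N refl = match-involutive M x<N

EdgeCover : ℕ → (ℕ → ℕ → Set) → ℕ → ℕ → Set
EdgeCover N R x y = Σ (PerfectMatchingOn R (_< N)) λ M → match M x ≡ y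

reverse-cover : ∀ {N R x y} → x < N → EdgeCover N R x y → EdgeCover N R y x
reverse-cover x<N (M , x↦y) = M , match-sym M x<N x↦y

threePMAdmissible :
  ∀ {N R} → Connected (finGraph N R) →
  (∀ {x y} → x < N → y < N → R x y → EdgeCover N R x y) →
  (M₁ M₂ M₃ : PerfectMatchingOn R (_< N)) →
  (∀ {x} → x < N → match M₁ x ≡ match M₂ x → match M₁ x ≡ match M₃ x → ⊥) →
  ThreePMAdmissible (finGraph N R)
threePMAdmissible {N} {R} connected covered M₁ M₂ M₃ disjoint =
  (connected , λ a b ab → let M , ab∈M = covered (toℕ<n a) (toℕ<n b) ab in
                          toPerfectMatching M , toℕ-injective (trans (toℕ-partner M a) ab∈M)) ,
  toPerfectMatching M₁ , toPerfectMatching M₂ , toPerfectMatching M₃ ,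
  λ a b _ (a∈M₁ , a∈M₂ , a∈M₃) →
    disjoint (toℕ<n a) (agree M₁ M₂ a∈M₁ a∈M₂) (agree M₁ M₃ a∈M₁ a∈M₃)
  where
  agree : ∀ {a b} (M M′ : PerfectMatchingOn R (_< N)) →
          partner (toPerfectMatching M) a ≡ b → partner (toPerfectMatching M′) a ≡ b →
          match M (toℕ a) ≡ match M′ (toℕ a)
  agree {a} M M′ eq eq′ =
    trans (sym (toℕ-partner M a)) (trans (cong toℕ (trans eq (sym eq′))) (toℕ-partner M′ a))

module _ {G : Graph} where

  _++ʷ_ : ∀ {a b c} → Walk G a b → Walk G b c → Walk G a c
  here ++ʷ w = w
  step e v ++ʷ w = step e (v ++ʷ w)

  connected-through : ∀ c → (∀ a → Walk G a c × Walk G c a) → Connected G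
  connected-through c walks a b = proj₁ (walks a) ++ʷ proj₂ (walks b)

-- Rim cycles with cut vertices

Rim : ℕ → ℕ → ℕ → Set
Rim L x y = x < L × y < L × CycAdj L x y

consecutive-rim : ∀ {L b} → b ≤ L → ∀ {x y} → x < b → y < b → Consecutive x y → Rim L x y
consecutive-rim b≤L x<b y<b (inj₁ eq) = <-≤-trans x<b b≤L , <-≤-trans y<b b≤L , inj₁ eq
consecutive-rim b≤L x<b y<b (inj₂ eq) = <-≤-trans x<b b≤L , <-≤-trans y<b b≤L , inj₂ (inj₁ eq)

-- EvenGaps s cs e: the increasing cut points cs split [s, e) into runs of
-- even length.
data EvenGaps (s : ℕ) : List ℕ → ℕ → Set where
  lastRun  : ∀ q {e} → s + q * 2 ≡ e → EvenGaps s [] e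
  cutAfter : ∀ q {c cs e} → s + q * 2 ≡ c → EvenGaps (suc c) cs e → EvenGaps s (c ∷ cs) e

Uncut : ℕ → List ℕ → ℕ → Pred ℕ _
Uncut s cs e x = s ≤ x × x < e × x ∉ cs

∉-singleton : ∀ {x j : ℕ} → x ≢ j → x ∉ j ∷ []
∉-singleton x≢j (here x≡j) = x≢j x≡j

evenGaps-≤ : ∀ {s cs e} → EvenGaps s cs e → s ≤ e
evenGaps-≤ {s} (lastRun q refl) = m≤m+n s _
evenGaps-≤ {s} (cutAfter q refl g) = ≤-trans (m≤m+n s _) (≤-trans (n≤1+n _) (evenGaps-≤ g))

evenGaps-cut : ∀ {s cs e c} → EvenGaps s cs e → c ∈ cs → s ≤ c × c < e
evenGaps-cut {s} (cutAfter q refl g) (here refl) = m≤m+n s _ , evenGaps-≤ g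
evenGaps-cut {s} (cutAfter q refl g) (there c∈cs) =
  let sc≤c , c<e = evenGaps-cut g c∈cs in ≤-trans (m≤m+n s _) (≤-trans (n≤1+n _) sc≤c) , c<e

module _ {L s q cs e} (g : EvenGaps (suc (s + q * 2)) cs e) (e≤L : e ≤ L)
         (rest : PerfectMatchingOn (Rim L) (Uncut (suc (s + q * 2)) cs e)) where

  private
    c = s + q * 2
    c≤L : c ≤ L
    c≤L = ≤-trans (n≤1+n c) (≤-trans (evenGaps-≤ g) e≤L)
    run : PerfectMatchingOn (Rim L) (Run s q)
    run = runMatching s q (consecutive-rim c≤L)
    disjoint : ∀ {x} → Run s q x → ¬ Uncut (suc c) cs e x
    disjoint (_ , x<c) (c<x , _) = <-asym x<c c<x

  prependRun : PerfectMatchingOn (Rim L) (Uncut s (c ∷ cs) e)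
  prependRun = reshape to from (union run rest disjoint)
    where
    to : ∀ {x} → Run s q x ⊎ Uncut (suc c) cs e x → Uncut s (c ∷ cs) e x
    to (inj₁ (s≤x , x<c)) = s≤x , <-trans x<c (evenGaps-≤ g) , λ
      { (here refl) → <-irrefl refl x<c
      ; (there x∈cs) → <-asym x<c (proj₁ (evenGaps-cut g x∈cs)) }
    to (inj₂ (c<x , x<e , x∉cs)) = ≤-trans (m≤m+n s _) (<⇒≤ c<x) , x<e , λ
      { (here refl) → <-irrefl refl c<x
      ; (there x∈cs) → x∉cs x∈cs }
    from : ∀ {x} → Uncut s (c ∷ cs) e x → Run s q x ⊎ Uncut (suc c) cs e x
    from {x} (s≤x , x<e , x∉) with x <? c
    ... | yes x<c = inj₁ (s≤x , x<c)
    ... | no x≮c = inj₂ (≤∧≢⇒< (≮⇒≥ x≮c) (λ c≡x → x∉ (here (sym c≡x))) , x<e , x∉ ∘ there)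

  prependRun-matchˡ : ∀ {x} → Run s q x → match prependRun x ≡ s + mate (x ∸ s)
  prependRun-matchˡ = union-matchˡ run rest disjoint

  prependRun-matchʳ : ∀ {x} → Uncut (suc c) cs e x → match prependRun x ≡ match rest x
  prependRun-matchʳ = union-matchʳ run rest disjoint

evenGapsMatching : ∀ {L s cs e} → EvenGaps s cs e → e ≤ L → PerfectMatchingOn (Rim L) (Uncut s cs e)
evenGapsMatching {s = s} (lastRun q refl) e≤L =
  reshape (λ (s≤x , x<e) → s≤x , x<e , λ ()) (λ (s≤x , x<e , _) → s≤x , x<e)
          (runMatching s q (consecutive-rim e≤L))
evenGapsMatching (cutAfter q refl g) e≤L = prependRun {q = q} g e≤L (evenGapsMatching g e≤L)

evenGaps-tail : ∀ {s c cs e} → EvenGaps s (c ∷ cs) e → EvenGaps (suc c) cs e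
evenGaps-tail (cutAfter _ _ g) = g

firstRun-match : ∀ {L s c cs e} (g : EvenGaps s (c ∷ cs) e) (e≤L : e ≤ L) {x} → s ≤ x → x < c →
                 match (evenGapsMatching g e≤L) x ≡ s + mate (x ∸ s)
firstRun-match (cutAfter q refl g) e≤L s≤x x<c =
  prependRun-matchˡ {q = q} g e≤L (evenGapsMatching g e≤L) (s≤x , x<c)

laterRuns-match : ∀ {L s c cs e} (g : EvenGaps s (c ∷ cs) e) (e≤L : e ≤ L) {x} → Uncut (suc c) cs e x →
                  match (evenGapsMatching g e≤L) x ≡ match (evenGapsMatching (evenGaps-tail g) e≤L) x
laterRuns-match (cutAfter q refl g) e≤L =
  prependRun-matchʳ {q = q} g e≤L (evenGapsMatching g e≤L)

-- All gaps between consecutive cuts around the cycle 0, …, L-1 are even: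
-- either the runs avoid the closing edge (L-1, 0), or that edge is matched and
-- the runs lie in [1, L-1).
CycleCuts : ℕ → List ℕ → Set
CycleCuts L cs = EvenGaps 0 cs L ⊎ EvenGaps 1 cs (pred L)

module _ {t cs} (g : EvenGaps 1 cs t) where

  private
    0<t : 0 < t
    0<t = evenGaps-≤ g
    closing : Rim (suc t) 0 t
    closing = z<s , n<1+n t , inj₂ (inj₂ (inj₁ (refl , refl)))
    closing′ : Rim (suc t) t 0
    closing′ = n<1+n t , z<s , inj₂ (inj₂ (inj₂ (refl , refl)))
    closingEdge : PerfectMatchingOn (Rim (suc t)) (Ends 0 t)
    closingEdge = edgeMatching (<⇒≢ 0<t) closing closing′
    disjoint : ∀ {x} → Ends 0 t x → ¬ Uncut 1 cs t x
    disjoint (inj₁ refl) (() , _)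
    disjoint (inj₂ refl) (_ , t<t , _) = <-irrefl refl t<t
    path : PerfectMatchingOn (Rim (suc t)) (Uncut 1 cs t)
    path = evenGapsMatching g (n≤1+n t)

  wrapMatching : PerfectMatchingOn (Rim (suc t)) (Uncut 0 cs (suc t))
  wrapMatching = reshape to from (union closingEdge path disjoint)
    where
    to : ∀ {x} → Ends 0 t x ⊎ Uncut 1 cs t x → Uncut 0 cs (suc t) x
    to (inj₁ (inj₁ refl)) = z≤n , z<s , λ 0∈cs → <-irrefl refl (proj₁ (evenGaps-cut g 0∈cs))
    to (inj₁ (inj₂ refl)) = z≤n , n<1+n t , λ t∈cs → <-irrefl refl (proj₂ (evenGaps-cut g t∈cs))
    to (inj₂ (_ , x<t , x∉cs)) = z≤n , <-trans x<t (n<1+n t) , x∉cs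
    from : ∀ {x} → Uncut 0 cs (suc t) x → Ends 0 t x ⊎ Uncut 1 cs t x
    from {zero} _ = inj₁ (inj₁ refl)
    from {suc x} (_ , x<st , x∉cs) with m<1+n⇒m<n∨m≡n x<st
    ... | inj₁ x<t = inj₂ (s≤s z≤n , x<t , x∉cs)
    ... | inj₂ x≡t = inj₁ (inj₂ x≡t)

  wrap-match₀ : match wrapMatching 0 ≡ t
  wrap-match₀ = trans (union-matchˡ closingEdge path disjoint (inj₁ refl)) (otherEnd-a 0 t)

  wrap-match-path : ∀ {x} → Uncut 1 cs t x → match wrapMatching x ≡ match path x
  wrap-match-path = union-matchʳ closingEdge path disjoint

cycleMatching : ∀ {L cs} → CycleCuts L cs → PerfectMatchingOn (Rim L) (Uncut 0 cs L)
cycleMatching (inj₁ g) = evenGapsMatching g ≤-refl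
cycleMatching {suc t} (inj₂ g) = wrapMatching g
cycleMatching {zero} (inj₂ g) with () ← evenGaps-≤ g

oddCycle-cut : ∀ m {j} → j < suc (m * 2) → CycleCuts (suc (m * 2)) (j ∷ [])
oddCycle-cut m {j} j<n with parity j
... | even a = inj₁ (cutAfter a refl (lastRun (m ∸ a) (cong suc (*2-split a≤m))))
  where a≤m = *-cancelʳ-≤ a m 2 (≤-pred j<n)
... | odd a = inj₂ (cutAfter a refl (lastRun (m ∸ suc a) (*2-split a<m)))
  where a<m = *-cancelʳ-< 2 a m (≤-pred j<n)

evenCycle-cuts-even-odd : ∀ {m a b} → a ≤ b → b < m → CycleCuts (m * 2) (a * 2 ∷ suc (b * 2) ∷ [])
evenCycle-cuts-even-odd {m} {a} {b} a≤b b<m =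
  inj₁ (cutAfter a refl (cutAfter (b ∸ a) (cong suc (*2-split a≤b)) (lastRun (m ∸ suc b) (*2-split b<m))))

evenCycle-cuts-odd-even : ∀ {m a b} → a < b → b < m → CycleCuts (m * 2) (suc (a * 2) ∷ b * 2 ∷ [])
evenCycle-cuts-odd-even {suc m₁} {a} {b} a<b b<m =
  inj₂ (cutAfter a refl (cutAfter (b ∸ suc a) (*2-split a<b)
                                  (lastRun (m₁ ∸ b) (cong suc (*2-split (≤-pred b<m))))))

-- Odd wheels

-- wheel n is finGraph (suc n) (WheelRel n), and doubleWheel k p is
-- finGraph (k + 2) (DoubleWheelRel k p), by definition.
WheelRel : ℕ → ℕ → ℕ → Set
WheelRel n x y = Rim n x y ⊎ (x ≡ n × y < n) ⊎ (y ≡ n × x < n)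

module _ {n j} (j<n : j < n) (cuts : CycleCuts n (j ∷ [])) where

  private
    spoke : PerfectMatchingOn (WheelRel n) (Ends n j)
    spoke = edgeMatching (>⇒≢ j<n) (inj₂ (inj₁ (refl , j<n))) (inj₂ (inj₂ (refl , j<n)))
    rim : PerfectMatchingOn (WheelRel n) (Uncut 0 (j ∷ []) n)
    rim = relax inj₁ (cycleMatching cuts)
    disjoint : ∀ {x} → Ends n j x → ¬ Uncut 0 (j ∷ []) n x
    disjoint (inj₁ refl) (_ , n<n , _) = <-irrefl refl n<n
    disjoint (inj₂ refl) (_ , _ , j∉) = j∉ (here refl)

  spokeMatching : PerfectMatchingOn (WheelRel n) (_< suc n)
  spokeMatching = reshape to from (union spoke rim disjoint)
    where
    to : ∀ {x} → Ends n j x ⊎ Uncut 0 (j ∷ []) n x → x < suc n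
    to (inj₁ (inj₁ refl)) = n<1+n n
    to (inj₁ (inj₂ refl)) = <-trans j<n (n<1+n n)
    to (inj₂ (_ , x<n , _)) = <-trans x<n (n<1+n n)
    from : ∀ {x} → x < suc n → Ends n j x ⊎ Uncut 0 (j ∷ []) n x
    from {x} x<sn with m<1+n⇒m<n∨m≡n x<sn | x ≟ j
    ... | inj₂ x≡n | _ = inj₁ (inj₁ x≡n)
    ... | inj₁ _ | yes x≡j = inj₁ (inj₂ x≡j)
    ... | inj₁ x<n | no x≢j = inj₂ (z≤n , x<n , ∉-singleton x≢j)

  spoke-match-hub : match spokeMatching n ≡ j
  spoke-match-hub = trans (union-matchˡ spoke rim disjoint (inj₁ refl))
                          (otherEnd-a n j)

  spoke-match-cut : match spokeMatching j ≡ n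
  spoke-match-cut = trans (union-matchˡ spoke rim disjoint (inj₂ refl)) (otherEnd-b (>⇒≢ j<n))

  spoke-match-rim : ∀ {x} → Uncut 0 (j ∷ []) n x → match spokeMatching x ≡ match (cycleMatching cuts) x
  spoke-match-rim = union-matchʳ spoke rim disjoint

module _ (m′ : ℕ) where

  private
    m = suc m′
    n = suc (m * 2)

    cuts₀ : CycleCuts n (0 ∷ [])
    cuts₀ = inj₁ (cutAfter 0 refl (lastRun m refl))
    cuts₁ : CycleCuts n (1 ∷ [])
    cuts₁ = inj₂ (cutAfter 0 refl (lastRun m′ refl))
    cutsTop : CycleCuts n (m * 2 ∷ [])
    cutsTop = inj₁ (cutAfter m refl (lastRun 0 (+-identityʳ n)))

    1<n : 1 < n
    1<n = s≤s (s≤s z≤n)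

    hub₀ hub₁ hubTop : PerfectMatchingOn (WheelRel n) (_< suc n)
    hub₀ = spokeMatching z<s cuts₀
    hub₁ = spokeMatching 1<n cuts₁
    hubTop = spokeMatching (n<1+n (m * 2)) cutsTop

    hub₀-match : ∀ {x} → 0 < x → x < n → match hub₀ x ≡ suc (mate (x ∸ 1))
    hub₀-match 0<x x<n =
      trans (spoke-match-rim z<s cuts₀ (z≤n , x<n , ∉-singleton (>⇒≢ 0<x)))
            (laterRuns-match (cutAfter 0 refl (lastRun m refl)) ≤-refl (0<x , x<n , λ ()))

    hub₁-match₀ : match hub₁ 0 ≡ m * 2
    hub₁-match₀ = trans (spoke-match-rim 1<n cuts₁ (z≤n , z<s , ∉-singleton λ ()))
                        (wrap-match₀ (cutAfter 0 refl (lastRun m′ refl)))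

    hub₁-match : ∀ {x} → 1 < x → x < m * 2 → match hub₁ x ≡ suc (suc (mate (x ∸ 2)))
    hub₁-match {x} 1<x x<t = begin
      match hub₁ x
        ≡⟨ spoke-match-rim 1<n cuts₁ (z≤n , <-trans x<t (n<1+n _) , ∉-singleton (>⇒≢ 1<x)) ⟩
      match (wrapMatching gaps) x
        ≡⟨ wrap-match-path gaps (<-trans z<s 1<x , x<t , ∉-singleton (>⇒≢ 1<x)) ⟩
      match (evenGapsMatching gaps (n≤1+n _)) x
        ≡⟨ laterRuns-match gaps (n≤1+n _) (1<x , x<t , λ ()) ⟩
      suc (suc (mate (x ∸ 2)))
        ∎
      where
      open ≡-Reasoning
      gaps = cutAfter 0 refl (lastRun m′ refl)

    hubTop-match : ∀ {x} → x < m * 2 → match hubTop x ≡ mate x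
    hubTop-match x<t =
      trans (spoke-match-rim (n<1+n (m * 2)) cutsTop (z≤n , <-trans x<t (n<1+n _) , ∉-singleton (<⇒≢ x<t)))
            (firstRun-match (cutAfter m refl (lastRun 0 (+-identityʳ n))) ≤-refl z≤n x<t)

    rimEdge : ∀ {x} → suc x < n → EdgeCover (suc n) (WheelRel n) x (suc x)
    rimEdge {x} sx<n with parity x
    ... | even a = hubTop , trans (hubTop-match (≤-pred sx<n)) (mate-even a)
    ... | odd a = hub₀ , trans (hub₀-match z<s (<-trans (n<1+n _) sx<n)) (cong suc (mate-even a))

    covered : ∀ {x y} → x < suc n → y < suc n → WheelRel n x y → EdgeCover (suc n) (WheelRel n) x y
    covered _ _ (inj₂ (inj₁ (refl , y<n))) =
      spokeMatching y<n (oddCycle-cut m y<n) , spoke-match-hub y<n (oddCycle-cut m y<n)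
    covered y<sn x<sn (inj₂ (inj₂ (refl , x<n))) =
      reverse-cover x<sn (covered x<sn y<sn (inj₂ (inj₁ (refl , x<n))))
    covered _ _ (inj₁ (_ , sx<n , inj₁ refl)) = rimEdge sx<n
    covered _ y<sn (inj₁ (sy<n , _ , inj₂ (inj₁ refl))) = reverse-cover y<sn (rimEdge sy<n)
    covered _ _ (inj₁ (_ , _ , inj₂ (inj₂ (inj₁ (refl , refl))))) = hub₁ , hub₁-match₀
    covered _ _ (inj₁ (_ , _ , inj₂ (inj₂ (inj₂ (refl , refl))))) = hub₁ , match-sym hub₁ z<s hub₁-match₀

    disjoint : ∀ {x} → x < suc n → match hub₀ x ≢ match hub₁ x
    disjoint {x} x<sn with m<1+n⇒m<n∨m≡n x<sn
    ... | inj₂ refl = λ eq →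
      0≢1+n (trans (sym (spoke-match-hub z<s cuts₀)) (trans eq (spoke-match-hub 1<n cuts₁)))
    disjoint {zero} _ | inj₁ _ = λ eq →
      1+n≢n (trans (sym (spoke-match-cut z<s cuts₀)) (trans eq hub₁-match₀))
    disjoint {suc zero} _ | inj₁ 1<n′ = λ eq →
      case trans (sym (hub₀-match z<s 1<n′)) (trans eq (spoke-match-cut 1<n cuts₁)) of λ ()
    disjoint {suc (suc y)} _ | inj₁ x<n with m<1+n⇒m<n∨m≡n x<n
    ... | inj₂ x≡t = λ eq →
      1+n≢0 (trans (sym (hub₀-match z<s x<n))
                   (trans eq (match-sym hub₁ z<s (trans hub₁-match₀ (sym x≡t)))))
    ... | inj₁ x<t = λ eq →
      mate-suc y (suc-injective (trans (sym (hub₀-match z<s x<n))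
                                       (trans eq (hub₁-match (s≤s (s≤s z≤n)) x<t))))

    connected : Connected (wheel n)
    connected = connected-through hub λ a → toHub a
      where
      hub = fromℕ n
      toHub : ∀ a → Walk (wheel n) a hub × Walk (wheel n) hub a
      toHub a with m<1+n⇒m<n∨m≡n (toℕ<n a)
      ... | inj₁ a<n = step (inj₂ (inj₂ (toℕ-fromℕ n , a<n))) here
                     , step (inj₂ (inj₁ (toℕ-fromℕ n , a<n))) here
      ... | inj₂ a≡n rewrite toℕ-injective {i = a} {j = hub} (trans a≡n (sym (toℕ-fromℕ n))) = here , here

  oddWheel-admissible : ThreePMAdmissible (wheel n)
  oddWheel-admissible = threePMAdmissible connected covered hub₀ hub₁ hub₁ (λ x<sn eq _ → disjoint x<sn eq)

-- Double wheels

DoubleWheelRel : ℕ → ℕ → ℕ → ℕ → Set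
DoubleWheelRel k p x y =
  Rim k x y ⊎
  (x ≡ k × y < p) ⊎
  (y ≡ k × x < p) ⊎
  (x ≡ suc k × p ≤ y × y < k) ⊎
  (y ≡ suc k × p ≤ x × x < k) ⊎
  (x ≡ k × y ≡ suc k) ⊎
  (y ≡ k × x ≡ suc k)

k<k+2 : ∀ k → k < k + 2
k<k+2 k = subst (k <_) (+-comm 2 k) (s≤s (n≤1+n k))

1+k<k+2 : ∀ k → suc k < k + 2
1+k<k+2 k = subst (suc k <_) (+-comm 2 k) (n<1+n (suc k))

<k+2-cases : ∀ {k x} → x < k + 2 → x < k ⊎ x ≡ k ⊎ x ≡ suc k
<k+2-cases {k} {x} x<N with m<1+n⇒m<n∨m≡n (subst (x <_) (+-comm k 2) x<N)
... | inj₂ x≡1+k = inj₂ (inj₂ x≡1+k)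
... | inj₁ x<1+k with m<1+n⇒m<n∨m≡n x<1+k
... | inj₂ x≡k = inj₂ (inj₁ x≡k)
... | inj₁ x<k = inj₁ x<k

module _ {k p : ℕ} where

  private
    R = DoubleWheelRel k p

    k<N = k<k+2 k
    sk<N = 1+k<k+2 k
    <k⇒<N : ∀ {x} → x < k → x < k + 2
    <k⇒<N x<k = <-trans x<k k<N

  module _ (cuts : CycleCuts k []) where

    private
      hubs : PerfectMatchingOn R (Ends k (suc k))
      hubs = edgeMatching (<⇒≢ (n<1+n k)) (inj₂ (inj₂ (inj₂ (inj₂ (inj₂ (inj₁ (refl , refl)))))))
                                          (inj₂ (inj₂ (inj₂ (inj₂ (inj₂ (inj₂ (refl , refl)))))))
      rim : PerfectMatchingOn R (Uncut 0 [] k)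
      rim = relax inj₁ (cycleMatching cuts)
      disjoint : ∀ {x} → Ends k (suc k) x → ¬ Uncut 0 [] k x
      disjoint (inj₁ refl) (_ , k<k , _) = <-irrefl refl k<k
      disjoint (inj₂ refl) (_ , sk<k , _) = <-asym sk<k (n<1+n k)

    uvMatching : PerfectMatchingOn R (_< k + 2)
    uvMatching = reshape to from (union hubs rim disjoint)
      where
      to : ∀ {x} → Ends k (suc k) x ⊎ Uncut 0 [] k x → x < k + 2
      to (inj₁ (inj₁ refl)) = k<N
      to (inj₁ (inj₂ refl)) = sk<N
      to (inj₂ (_ , x<k , _)) = <k⇒<N x<k
      from : ∀ {x} → x < k + 2 → Ends k (suc k) x ⊎ Uncut 0 [] k x
      from x<N with <k+2-cases x<N
      ... | inj₁ x<k = inj₂ (z≤n , x<k , λ ())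
      ... | inj₂ (inj₁ x≡k) = inj₁ (inj₁ x≡k)
      ... | inj₂ (inj₂ x≡sk) = inj₁ (inj₂ x≡sk)

    uv-match-u : match uvMatching k ≡ suc k
    uv-match-u = trans (union-matchˡ hubs rim disjoint (inj₁ refl)) (otherEnd-a k (suc k))

    uv-match-rim : ∀ {x} → x < k → match uvMatching x ≡ match (cycleMatching cuts) x
    uv-match-rim x<k = union-matchʳ hubs rim disjoint (z≤n , x<k , λ ())

  module _ {i j} (i<p : i < p) (p≤j : p ≤ j) (j<k : j < k) (cuts : CycleCuts k (i ∷ j ∷ [])) where

    private
      i<j = <-≤-trans i<p p≤j
      i<k = <-trans i<j j<k
      spokeU : PerfectMatchingOn R (Ends k i)
      spokeU = edgeMatching (>⇒≢ i<k) (inj₂ (inj₁ (refl , i<p))) (inj₂ (inj₂ (inj₁ (refl , i<p))))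
      spokeV : PerfectMatchingOn R (Ends (suc k) j)
      spokeV = edgeMatching (>⇒≢ (<-trans j<k (n<1+n k)))
                 (inj₂ (inj₂ (inj₂ (inj₁ (refl , p≤j , j<k)))))
                 (inj₂ (inj₂ (inj₂ (inj₂ (inj₁ (refl , p≤j , j<k))))))
      disjointᵤᵥ : ∀ {x} → Ends k i x → ¬ Ends (suc k) j x
      disjointᵤᵥ (inj₁ refl) (inj₁ k≡sk) = 1+n≢n (sym k≡sk)
      disjointᵤᵥ (inj₁ refl) (inj₂ refl) = <-irrefl refl j<k
      disjointᵤᵥ (inj₂ refl) (inj₁ refl) = <-asym i<k (n<1+n k)
      disjointᵤᵥ (inj₂ refl) (inj₂ refl) = <-irrefl refl i<j
      spokes : PerfectMatchingOn R (λ x → Ends k i x ⊎ Ends (suc k) j x)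
      spokes = union spokeU spokeV disjointᵤᵥ
      rim : PerfectMatchingOn R (Uncut 0 (i ∷ j ∷ []) k)
      rim = relax inj₁ (cycleMatching cuts)
      disjoint : ∀ {x} → Ends k i x ⊎ Ends (suc k) j x → ¬ Uncut 0 (i ∷ j ∷ []) k x
      disjoint (inj₁ (inj₁ refl)) (_ , k<k , _) = <-irrefl refl k<k
      disjoint (inj₁ (inj₂ refl)) (_ , _ , i∉) = i∉ (here refl)
      disjoint (inj₂ (inj₁ refl)) (_ , sk<k , _) = <-asym sk<k (n<1+n k)
      disjoint (inj₂ (inj₂ refl)) (_ , _ , j∉) = j∉ (there (here refl))

    spokesMatching : PerfectMatchingOn R (_< k + 2)
    spokesMatching = reshape to from (union spokes rim disjoint)
      where
      to : ∀ {x} → (Ends k i x ⊎ Ends (suc k) j x) ⊎ Uncut 0 (i ∷ j ∷ []) k x → x < k + 2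
      to (inj₁ (inj₁ (inj₁ refl))) = k<N
      to (inj₁ (inj₁ (inj₂ refl))) = <k⇒<N i<k
      to (inj₁ (inj₂ (inj₁ refl))) = sk<N
      to (inj₁ (inj₂ (inj₂ refl))) = <k⇒<N j<k
      to (inj₂ (_ , x<k , _)) = <k⇒<N x<k
      from : ∀ {x} → x < k + 2 → (Ends k i x ⊎ Ends (suc k) j x) ⊎ Uncut 0 (i ∷ j ∷ []) k x
      from {x} x<N with <k+2-cases x<N
      ... | inj₂ (inj₁ x≡k) = inj₁ (inj₁ (inj₁ x≡k))
      ... | inj₂ (inj₂ x≡sk) = inj₁ (inj₂ (inj₁ x≡sk))
      ... | inj₁ x<k with x ≟ i | x ≟ j
      ... | yes x≡i | _ = inj₁ (inj₁ (inj₂ x≡i))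
      ... | no _ | yes x≡j = inj₁ (inj₂ (inj₂ x≡j))
      ... | no x≢i | no x≢j =
        inj₂ (z≤n , x<k , λ { (here x≡i) → x≢i x≡i ; (there (here x≡j)) → x≢j x≡j })

    spokes-match-u : match spokesMatching k ≡ i
    spokes-match-u = trans (union-matchˡ spokes rim disjoint (inj₁ (inj₁ refl)))
                   (trans (union-matchˡ spokeU spokeV disjointᵤᵥ (inj₁ refl)) (otherEnd-a k i))

    spokes-match-v : match spokesMatching (suc k) ≡ j
    spokes-match-v = trans (union-matchˡ spokes rim disjoint (inj₂ (inj₁ refl)))
                   (trans (union-matchʳ spokeU spokeV disjointᵤᵥ (inj₁ refl))
                          (otherEnd-a (suc k) j))

module _ (m₂ p : ℕ) (2≤p : 2 ≤ p) (p+2≤k : p + 2 ≤ suc (suc m₂) * 2) where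

  private
    m₁ = suc m₂
    m = suc m₁
    k = m * 2
    t = suc (m₁ * 2)
    R = DoubleWheelRel k p

    k<N = k<k+2 k
    p≤k-2 : p ≤ m₁ * 2
    p≤k-2 = ≤-pred (≤-pred (subst (_≤ k) (+-comm p 2) p+2≤k))

    cutsA : CycleCuts k []
    cutsA = inj₁ (lastRun m refl)
    cutsB : CycleCuts k []
    cutsB = inj₂ (lastRun m₁ refl)
    cutsC : CycleCuts k (0 ∷ t ∷ [])
    cutsC = evenCycle-cuts-even-odd {m} z≤n (n<1+n m₁)

    Mᴬ Mᴮ Mᶜ : PerfectMatchingOn R (_< k + 2)
    Mᴬ = uvMatching cutsA
    Mᴮ = uvMatching cutsB
    Mᶜ = spokesMatching (<-trans z<s 2≤p) (≤-trans p≤k-2 (n≤1+n _)) (n<1+n t) cutsC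

    Mᴬ-match : ∀ {x} → x < k → match Mᴬ x ≡ mate x
    Mᴬ-match = uv-match-rim {p = p} cutsA

    Mᴮ-match₀ : match Mᴮ 0 ≡ t
    Mᴮ-match₀ = trans (uv-match-rim {p = p} cutsB z<s) (wrap-match₀ (lastRun m₁ refl))

    Mᴮ-match : ∀ {x} → 0 < x → x < t → match Mᴮ x ≡ suc (mate (x ∸ 1))
    Mᴮ-match 0<x x<t = trans (uv-match-rim {p = p} cutsB (<-trans x<t (n<1+n t)))
                             (wrap-match-path (lastRun m₁ refl) (0<x , x<t , λ ()))

    rimEdge : ∀ {x} → suc x < k → EdgeCover (k + 2) R x (suc x)
    rimEdge {x} sx<k with parity x
    ... | even a = Mᴬ , trans (Mᴬ-match (<-trans (n<1+n _) sx<k)) (mate-even a)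
    ... | odd a = Mᴮ , trans (Mᴮ-match z<s (≤-pred sx<k)) (cong suc (mate-even a))

    spokeᵤ : ∀ {i} → i < p → EdgeCover (k + 2) R k i
    spokeᵤ {i} i<p with parity i
    ... | even a = spokesMatching i<p p≤t (n<1+n t) cuts , spokes-match-u i<p p≤t (n<1+n t) cuts
      where
      p≤t = ≤-trans p≤k-2 (n≤1+n _)
      cuts = evenCycle-cuts-even-odd (*-cancelʳ-≤ a m₁ 2 (≤-trans (<⇒≤ i<p) p≤k-2)) (n<1+n m₁)
    ... | odd a = spokesMatching i<p p≤k-2 k-2<k cuts , spokes-match-u i<p p≤k-2 k-2<k cuts
      where
      k-2<k = <-trans (n<1+n _) (n<1+n t)
      cuts = evenCycle-cuts-odd-even (*-cancelʳ-< 2 a m₁ (<-≤-trans (n<1+n _) (≤-trans (<⇒≤ i<p) p≤k-2)))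
                                     (n<1+n m₁)

    spokeᵥ : ∀ {j} → p ≤ j → j < k → EdgeCover (k + 2) R (suc k) j
    spokeᵥ {j} p≤j j<k with parity j
    ... | odd b = spokesMatching 0<p p≤j j<k cuts , spokes-match-v 0<p p≤j j<k cuts
      where
      0<p = <-trans z<s 2≤p
      cuts = evenCycle-cuts-even-odd {m} z≤n (*-cancelʳ-< 2 b m (<-trans (n<1+n _) j<k))
    ... | even zero = ⊥-elim (<⇒≱ (<-trans z<s 2≤p) p≤j)
    ... | even (suc b) = spokesMatching 2≤p p≤j j<k cuts , spokes-match-v 2≤p p≤j j<k cuts
      where
      cuts = evenCycle-cuts-odd-even {m} z<s (*-cancelʳ-< 2 (suc b) m j<k)

    covered : ∀ {x y} → x < k + 2 → y < k + 2 → R x y → EdgeCover (k + 2) R x y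
    covered _ _ (inj₁ (_ , sx<k , inj₁ refl)) = rimEdge sx<k
    covered _ y<N (inj₁ (sy<k , _ , inj₂ (inj₁ refl))) = reverse-cover y<N (rimEdge sy<k)
    covered _ _ (inj₁ (_ , _ , inj₂ (inj₂ (inj₁ (refl , sy≡k))))) =
      Mᴮ , trans Mᴮ-match₀ (sym (suc-injective sy≡k))
    covered x<N y<N (inj₁ (x<k , y<k , inj₂ (inj₂ (inj₂ (refl , sx≡k))))) =
      reverse-cover y<N (covered y<N x<N (inj₁ (y<k , x<k , inj₂ (inj₂ (inj₁ (refl , sx≡k))))))
    covered _ _ (inj₂ (inj₁ (refl , y<p))) = spokeᵤ y<p
    covered _ _ (inj₂ (inj₂ (inj₁ (refl , x<p)))) = reverse-cover k<N (spokeᵤ x<p)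
    covered _ _ (inj₂ (inj₂ (inj₂ (inj₁ (refl , p≤y , y<k))))) = spokeᵥ p≤y y<k
    covered _ y<N (inj₂ (inj₂ (inj₂ (inj₂ (inj₁ (refl , p≤x , x<k)))))) =
      reverse-cover y<N (spokeᵥ p≤x x<k)
    covered _ _ (inj₂ (inj₂ (inj₂ (inj₂ (inj₂ (inj₁ (refl , refl))))))) = Mᴬ , uv-match-u {p = p} cutsA
    covered _ _ (inj₂ (inj₂ (inj₂ (inj₂ (inj₂ (inj₂ (refl , refl))))))) =
      Mᴬ , match-sym Mᴬ k<N (uv-match-u {p = p} cutsA)

    t≢1 : t ≢ 1
    t≢1 ()

    disjoint : ∀ {x} → x < k + 2 → match Mᴬ x ≡ match Mᴮ x → match Mᴬ x ≡ match Mᶜ x → ⊥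
    disjoint x<N _ ᴬ≡ᶜ with <k+2-cases {k} x<N
    ... | inj₂ (inj₁ refl) =
      1+n≢0 (trans (sym (uv-match-u {p = p} cutsA)) (trans ᴬ≡ᶜ (spokes-match-u _ _ _ cutsC)))
    ... | inj₂ (inj₂ refl) =
      1+n≢n (trans (sym (match-sym Mᴬ k<N (uv-match-u {p = p} cutsA)))
                   (trans ᴬ≡ᶜ (spokes-match-v _ _ _ cutsC)))
    disjoint {zero} _ ᴬ≡ᴮ _ | inj₁ 0<k = t≢1 (sym (trans (sym (Mᴬ-match 0<k)) (trans ᴬ≡ᴮ Mᴮ-match₀)))
    disjoint {suc y} _ ᴬ≡ᴮ _ | inj₁ x<k with m<1+n⇒m<n∨m≡n x<k
    ... | inj₂ refl = t≢1 (begin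
          t                 ≡⟨ mate-involutive t ⟨
          mate (mate t)     ≡⟨ cong mate (trans (sym (Mᴬ-match x<k)) ᴬ≡ᴮ) ⟩
          mate (match Mᴮ t) ≡⟨ cong mate (match-sym Mᴮ (<-trans z<s k<N) Mᴮ-match₀) ⟩
          1                 ∎)
      where open ≡-Reasoning
    ... | inj₁ x<t = mate-suc y (trans (sym (Mᴬ-match x<k)) (trans ᴬ≡ᴮ (Mᴮ-match z<s x<t)))

    connected : Connected (doubleWheel k p)
    connected = connected-through u λ a → walks a
      where
      sk<N = 1+k<k+2 k
      u v : Fin (k + 2)
      u = fromℕ< k<N
      v = fromℕ< sk<N
      uℕ : toℕ u ≡ k
      uℕ = toℕ-fromℕ< k<N
      vℕ : toℕ v ≡ suc k
      vℕ = toℕ-fromℕ< sk<N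
      walks : ∀ a → Walk (doubleWheel k p) a u × Walk (doubleWheel k p) u a
      walks a with <k+2-cases {k} (toℕ<n a)
      ... | inj₂ (inj₁ a≡k) rewrite toℕ-injective {i = a} {j = u} (trans a≡k (sym uℕ)) = here , here
      ... | inj₂ (inj₂ a≡sk) = step (inj₂ (inj₂ (inj₂ (inj₂ (inj₂ (inj₂ (uℕ , a≡sk))))))) here
                             , step (inj₂ (inj₂ (inj₂ (inj₂ (inj₂ (inj₁ (uℕ , a≡sk))))))) here
      ... | inj₁ a<k with p ≤? toℕ a
      ... | no a≱p = step (inj₂ (inj₂ (inj₁ (uℕ , ≰⇒> a≱p)))) here
                   , step (inj₂ (inj₁ (uℕ , ≰⇒> a≱p))) here
      ... | yes p≤a = step {b = v} (inj₂ (inj₂ (inj₂ (inj₂ (inj₁ (vℕ , p≤a , a<k))))))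
                           (step (inj₂ (inj₂ (inj₂ (inj₂ (inj₂ (inj₂ (uℕ , vℕ))))))) here)
                    , step {b = v} (inj₂ (inj₂ (inj₂ (inj₂ (inj₂ (inj₁ (uℕ , vℕ)))))))
                           (step (inj₂ (inj₂ (inj₂ (inj₁ (vℕ , p≤a , a<k))))) here)

  evenDoubleWheel-admissible : ThreePMAdmissible (doubleWheel k p)
  evenDoubleWheel-admissible = threePMAdmissible connected covered Mᴬ Mᴮ Mᶜ disjoint

-- The octahedron

module _ (G : Graph) (adj? : ∀ a b → Dec (Adj G a b)) where

  IsPartner : (Fin (order G) → Fin (order G)) → Fin (order G) → Set
  IsPartner f a = f (f a) ≡ a × f a ≢ a × Adj G a (f a)

  isPartner? : ∀ f a → Dec (IsPartner f a)
  isPartner? f a = (f (f a) ≟ᶠ a) ×-dec ¬? (f a ≟ᶠ a) ×-dec adj? a (f a)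

  partnerMatching : (f : Fin (order G) → Fin (order G)) → (∀ a → IsPartner f a) → PerfectMatching G
  partnerMatching f is = record
    { partner  = f
    ; invol    = λ a → let inv , _ , _ = is a in inv
    ; noFix    = λ a → let _ , nf , _ = is a in nf
    ; adjacent = λ a → let _ , _ , ad = is a in ad
    }

module Octahedron where

  open import Data.Fin using (zero; suc; #_)
  open import Data.Vec using (lookup; _∷_; [])

  octAdj? : ∀ a b → Dec (OctAdj a b)
  octAdj? a b = ¬? (toℕ a / 2 ≟ toℕ b / 2)

  oct₀ oct₁ oct₂ oct₃ : Fin 6 → Fin 6
  oct₀ = lookup (# 2 ∷ # 4 ∷ # 0 ∷ # 5 ∷ # 1 ∷ # 3 ∷ [])
  oct₁ = lookup (# 3 ∷ # 5 ∷ # 4 ∷ # 0 ∷ # 2 ∷ # 1 ∷ [])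
  oct₂ = lookup (# 4 ∷ # 3 ∷ # 5 ∷ # 1 ∷ # 0 ∷ # 2 ∷ [])
  oct₃ = lookup (# 5 ∷ # 2 ∷ # 1 ∷ # 4 ∷ # 3 ∷ # 0 ∷ [])

  octMatching : (f : Fin 6 → Fin 6) → {True (all? (isPartner? octahedron octAdj? f))} →
                PerfectMatching octahedron
  octMatching f {ok} = partnerMatching octahedron octAdj? f (toWitness ok)

  O₀ O₁ O₂ O₃ : PerfectMatching octahedron
  O₀ = octMatching oct₀
  O₁ = octMatching oct₁
  O₂ = octMatching oct₂
  O₃ = octMatching oct₃

  oct-factorisation : ∀ a b → OctAdj a b → oct₀ a ≡ b ⊎ oct₁ a ≡ b ⊎ oct₂ a ≡ b ⊎ oct₃ a ≡ b
  oct-factorisation = toWitness {a? = all? λ a → all? λ b → octAdj? a b →-dec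
    ((oct₀ a ≟ᶠ b) ⊎-dec (oct₁ a ≟ᶠ b) ⊎-dec (oct₂ a ≟ᶠ b) ⊎-dec (oct₃ a ≟ᶠ b))} _

  oct₀≢oct₁ : ∀ a → oct₀ a ≢ oct₁ a
  oct₀≢oct₁ = toWitness {a? = all? λ a → ¬? (oct₀ a ≟ᶠ oct₁ a)} _

  octahedron-connected : Connected octahedron
  octahedron-connected = connected-through zero walks
    where
    walks : ∀ a → Walk octahedron a zero × Walk octahedron zero a
    walks zero = here , here
    walks (suc zero) = step {b = # 2} (λ ()) (step (λ ()) here)
                     , step {b = # 2} (λ ()) (step (λ ()) here)
    walks (suc (suc zero)) = step (λ ()) here , step (λ ()) here
    walks (suc (suc (suc zero))) = step (λ ()) here , step (λ ()) here
    walks (suc (suc (suc (suc zero)))) = step (λ ()) here , step (λ ()) here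
    walks (suc (suc (suc (suc (suc zero))))) = step (λ ()) here , step (λ ()) here

  octahedron-admissible : ThreePMAdmissible octahedron
  octahedron-admissible =
    (octahedron-connected , covered) , O₀ , O₁ , O₂ ,
    λ a _ _ (a∈O₀ , a∈O₁ , _) → oct₀≢oct₁ a (trans a∈O₀ (sym a∈O₁))
    where
    covered : ∀ a b → OctAdj a b → Σ (PerfectMatching octahedron) λ M → partner M a ≡ b
    covered a b ab with oct-factorisation a b ab
    ... | inj₁ a∈O₀ = O₀ , a∈O₀
    ... | inj₂ (inj₁ a∈O₁) = O₁ , a∈O₁
    ... | inj₂ (inj₂ (inj₁ a∈O₂)) = O₂ , a∈O₂
    ... | inj₂ (inj₂ (inj₂ a∈O₃)) = O₃ , a∈O₃

open Octahedron using (octahedron-admissible)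

odd-∤ : ∀ a → ¬ 2 ∣ suc (a * 2)
odd-∤ a (divides q eq) = odd≢even a q eq

corollary2p2 :
    (∀ (n : ℕ) → ¬ (2 ∣ n) → 3 ≤ n → ThreePMAdmissible (wheel n)) ×
    (∀ (k p : ℕ) → 2 ≤ p → p + 2 ≤ k → 2 ∣ (k + 2) → ThreePMAdmissible (doubleWheel k p)) ×
    ThreePMAdmissible octahedron
corollary2p2 = oddWheels , evenDoubleWheels , octahedron-admissible
  where
  oddWheels : ∀ n → ¬ 2 ∣ n → 3 ≤ n → ThreePMAdmissible (wheel n)
  oddWheels n 2∤n 3≤n with parity n
  ... | even a = ⊥-elim (2∤n (divides a refl))
  ... | odd zero = ⊥-elim (<⇒≱ 3≤n (s≤s z≤n))
  ... | odd (suc m′) = oddWheel-admissible m′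
  evenDoubleWheels : ∀ k p → 2 ≤ p → p + 2 ≤ k → 2 ∣ k + 2 → ThreePMAdmissible (doubleWheel k p)
  evenDoubleWheels k p 2≤p p+2≤k 2∣k+2 with parity k
  ... | odd a = ⊥-elim (odd-∤ (suc a) (subst (2 ∣_) (+-comm k 2) 2∣k+2))
  ... | even zero = ⊥-elim (<⇒≱ (s≤s z≤n) (≤-trans (m≤n+m 2 p) p+2≤k))
  ... | even (suc zero) = ⊥-elim (<⇒≱ (s≤s (s≤s (s≤s z≤n))) (≤-trans (+-monoˡ-≤ 2 2≤p) p+2≤k))
  ... | even (suc (suc m₂)) = evenDoubleWheel-admissible m₂ p 2≤p p+2≤k
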